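{- Let $t\ge 1$ be an integer. The ordinary generating function, with respect to length, of GDAP (including the empty path) all of whose vertices have ordinate between $-t$ and $t$ (inclusive) is $$\frac{D_{t-1}}{D_{2t}}\left(D_t+N_{t+1}^t\right),$$ where $(D_s)_{s\ge 0}$ is the sequence of polynomials in $x$ defined by $D_0=1$, $D_1=1-x^2$ and $D_{s+2}+(x^2-x-1)D_{s+1}+xD_s=0$ for $s\ge 0$, and $$N_{t+1}^t=\frac{2^{t+2}x^{t+3}(-1)^t}{W(x^2-x-1)^2-W^3}\left(\frac{1}{(x^2-x-1+W)^t}-\frac{1}{(x^2-x-1-W)^t}\right),\qquad W=\sqrt{x^4-2x^3-x^2-2x+1}.$$
   Context: A grand Dyck path with air pockets (GDAP) is a lattice path in $\mathbb{Z}^2$ starting at $(0,0)$ and ending on the $x$-axis, consisting of up-steps $U=(1,1)$ and down-steps $D_k=(1,-k)$ with $k\ge 1$, such that no two down-steps are consecutive; the path may go below the $x$-axis, and the empty path is a GDAP. The length of a path is its number of steps. $W$ denotes the formal power series square root with constant term $1$. -}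

module Defs where

open import Data.Bool using (Bool; true; false; _∧_; T)
open import Data.Nat as ℕ using (ℕ; zero; suc; _∸_)
open import Data.Integer as ℤ using (ℤ; +_; -[1+_]; _≤ᵇ_)
open import Data.Rational as ℚ using (ℚ; 0ℚ; 1ℚ)
open import Data.List using (List; []; _∷_; length; map; foldr; upTo)
open import Data.Product using (Σ; _×_)
open import Data.Fin using (Fin)
open import Relation.Binary.PropositionalEquality using (_≡_)

-- U = (1,1);  D k = (1, -(k+1)), i.e. D k is the paper's D_{k+1}
data Step : Set where
  U : Step
  D : ℕ → Step

δ : Step → ℤ
δ U     = + 1
δ (D k) = -[1+ k ]

noConsecDown : List Step → Bool
noConsecDown []                = true
noConsecDown (U ∷ p)           = noConsecDown p
noConsecDown (D k ∷ [])        = true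
noConsecDown (D k ∷ U ∷ p)     = noConsecDown (U ∷ p)
noConsecDown (D k ∷ D j ∷ p)   = false

inBand : ℕ → ℤ → Bool
inBand t h = (ℤ.- (+ t) ≤ᵇ h) ∧ (h ≤ᵇ + t)

isZero : ℤ → Bool
isZero (+ zero) = true
isZero _        = false

bandWalk : ℕ → ℤ → List Step → Bool
bandWalk t h []      = inBand t h ∧ isZero h
bandWalk t h (s ∷ p) = inBand t h ∧ bandWalk t (h ℤ.+ δ s) p

isBoundedGDAP : ℕ → List Step → Bool
isBoundedGDAP t p = noConsecDown p ∧ bandWalk t (+ 0) p

BoundedGDAP : ℕ → ℕ → Set
BoundedGDAP t n = Σ (List Step) (λ p → (length p ≡ n) × T (isBoundedGDAP t p))

PS : Set
PS = ℕ → ℚ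

_≈_ : PS → PS → Set
f ≈ g = ∀ n → f n ≡ g n
infix 4 _≈_

infixl 6 _⊕_ _⊖_
infixl 7 _⊛_

_⊕_ : PS → PS → PS
(f ⊕ g) n = f n ℚ.+ g n

_⊖_ : PS → PS → PS
(f ⊖ g) n = f n ℚ.- g n

sumℚ : List ℚ → ℚ
sumℚ = foldr ℚ._+_ 0ℚ

_⊛_ : PS → PS → PS
(f ⊛ g) n = sumℚ (map (λ i → f i ℚ.* g (n ∸ i)) (upTo (suc n)))

const : ℚ → PS
const c zero    = c
const c (suc n) = 0ℚ

one : PS
one = const 1ℚ

X : PS
X zero          = 0ℚ
X (suc zero)    = 1ℚ
X (suc (suc n)) = 0ℚ

_^ₚ_ : PS → ℕ → PS
f ^ₚ zero  = one
f ^ₚ suc k = f ⊛ (f ^ₚ k)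

ℤc : ℤ → PS
ℤc z = const (z ℚ./ 1)

A : PS
A = X ^ₚ 2 ⊖ X ⊖ one

P : PS
P = X ^ₚ 4 ⊖ ℤc (+ 2) ⊛ X ^ₚ 3 ⊖ X ^ₚ 2 ⊖ ℤc (+ 2) ⊛ X ⊕ one

Dpoly : ℕ → PS
Dpoly zero            = one
Dpoly (suc zero)      = one ⊖ X ^ₚ 2
Dpoly (suc (suc s))   = const 0ℚ ⊖ A ⊛ Dpoly (suc s) ⊖ X ⊛ Dpoly s

{-# OPTIONS --safe #-}

-- Shift heights by t, so that a bounded GDAP is a walk in the strip [0, 2t]
-- from t to t. Splitting off the first step (a down-step from height m may
-- land at any j < m) shows that the generating functions T_m of walks from
-- height m satisfy
--   x T_{m+2} + (x² - x - 1) T_{m+1} + T_m = (1 - x)[m = t] - [m + 1 = t],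
-- with T_m = 0 above the strip. So u_m = x^m T_m obeys the recurrence of D
-- up to two impulses at the target; as a second-order recurrence has unique
-- solutions, u_m = T_0 D_{m-1} + x^t (x(1 - x) E_{m-t-1} - E_{m-t}), where E
-- solves the recurrence with E_0 = 0, E_1 = 1 (and vanishes at negative
-- indices). At m = t this reads x^t T_t = T_0 D_{t-1}, and at m = 2t + 1,
-- where u vanishes, T_0 D_{2t} = x^t (D_t + x² E_t). Hence
-- T_t D_{2t} = D_{t-1} (D_t + x² E_t). Finally N = x² E_t has the stated
-- closed form: A ± W are the roots of z² - 2Az + 4x, whence
-- (A - W)^t - (A + W)^t = (-2)^t W E_t.
module Submission where

open import Defs
open import Data.Nat using (ℕ; _≤_; _∸_; _+_; _*_; _^_)
open import Data.Integer using (ℤ; +_; -[1+_]) renaming (_*_ to _*ℤ_; _^_ to _^ℤ_)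
open import Data.Rational using (ℚ; 1ℚ; _/_)
open import Data.Fin using (Fin)
open import Data.Product using (Σ; _×_)
open import Function.Bundles using (_↔_)
open import Relation.Binary.PropositionalEquality using (_≡_)

open import Algebra.Bundles using (CommutativeMonoid; CommutativeRing)
import Algebra.Properties.CommutativeSemiring.Exp as Exp
import Algebra.Solver.Ring as RingSolver
open import Algebra.Solver.Ring.AlmostCommutativeRing
  using (fromCommutativeRing; _-Raw-AlmostCommutative⟶_)
open import Data.Bool using (Bool; true; false; _∧_; T; if_then_else_)
open import Data.Bool.Properties using (T-irrelevant; T-∧; T-≡; ∧-zeroʳ; ∧-commutativeMonoid)
open import Data.Empty using (⊥; ⊥-elim)
open import Data.Fin.Permutation using (↔⇒≡)
import Data.Fin.Properties as Finₚ
import Data.Integer as ℤ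
import Data.Integer.Properties as ℤₚ
import Data.Integer.Solver as ℤSolver
open import Data.List using (List; []; _∷_; length; applyUpTo)
open import Data.List.Properties using (map-upTo)
open import Data.Maybe using (Maybe; just; nothing)
open import Data.Nat using (zero; suc; _<_; _≤ᵇ_; _<ᵇ_; _≡ᵇ_; z≤n; s≤s)
import Data.Nat.Coprimality as Coprimality
import Data.Nat.Properties as ℕₚ
open import Data.Product using (_,_; proj₁; proj₂)
import Data.Rational as ℚ
import Data.Rational.Properties as ℚₚ
import Data.Rational.Solver as ℚSolver
open import Data.Sum using (_⊎_; inj₁; inj₂)
open import Data.Sum.Function.Propositional using (_⊎-↔_)
open import Data.Unit using (tt)
open import Function using (_∘_)
open import Function.Bundles using (mk↔ₛ′; module Equivalence)
open import Function.Properties.Inverse using (↔-trans; ↔-sym)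
open import Relation.Binary.PropositionalEquality
  using (refl; sym; trans; cong; cong₂; subst; subst₂; module ≡-Reasoning)
open import Relation.Binary.Structures using (IsEquivalence)
open import Relation.Nullary using (yes; no)

open Equivalence using (to; from)
open import Algebra.Properties.CommutativeSemigroup
  (CommutativeMonoid.commutativeSemigroup ∧-commutativeMonoid) using (x∙yz≈y∙xz)

-- The Bool argument records whether the previous step was a down-step.
module Strip (L target : ℕ) where

  isWalk : ℕ → Bool → List Step → Bool
  isWalk m _     []        = (m ≤ᵇ L) ∧ (m ≡ᵇ target)
  isWalk m _     (U ∷ p)   = (m ≤ᵇ L) ∧ isWalk (suc m) false p
  isWalk m false (D k ∷ p) = (m ≤ᵇ L) ∧ ((k <ᵇ m) ∧ isWalk (m ∸ suc k) true p)
  isWalk m true  (D k ∷ p) = false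

  Walk : ℕ → Bool → ℕ → Set
  Walk m f n = Σ (List Step) (λ p → (length p ≡ n) × T (isWalk m f p))

  WalkBelow : ℕ → ℕ → Set
  WalkBelow b n = Σ ℕ (λ j → j < b × Walk j true n)

  DownWalk : ℕ → Bool → ℕ → Set
  DownWalk m true  n = ⊥
  DownWalk m false n = WalkBelow m n

  mutual
    count : ℕ → Bool → ℕ → ℕ
    count m f zero    = if (m ≤ᵇ L) ∧ (m ≡ᵇ target) then 1 else 0
    count m f (suc n) = if m ≤ᵇ L then count (suc m) false n + countDown m f n else 0

    countDown : ℕ → Bool → ℕ → ℕ
    countDown m true  n = 0
    countDown m false n = countBelow m n

    countBelow : ℕ → ℕ → ℕ
    countBelow zero    n = 0
    countBelow (suc j) n = count j true n + countBelow j n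

  walk-≡ : ∀ {m f n} {v w : Walk m f n} → proj₁ v ≡ proj₁ w → v ≡ w
  walk-≡ {v = p , l , w} {.p , l′ , w′} refl =
    cong₂ (λ a b → p , a , b) (ℕₚ.≡-irrelevant l l′) (T-irrelevant w w′)

  walkBelow-≡ : ∀ {b n} {v w : WalkBelow b n} →
                proj₁ v ≡ proj₁ w → proj₁ (proj₂ (proj₂ v)) ≡ proj₁ (proj₂ (proj₂ w)) → v ≡ w
  walkBelow-≡ {v = j , j<b , v} {.j , j<b′ , w} refl p≡q =
    cong₂ (λ a b → j , a , b) (ℕₚ.<-irrelevant j<b j<b′) (walk-≡ p≡q)

  up-rest : ∀ {m f p} → T (isWalk m f (U ∷ p)) → T (isWalk (suc m) false p)
  up-rest {m} w = proj₂ (to (T-∧ {m ≤ᵇ L}) w)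

  down-< : ∀ {m k p} → T (isWalk m false (D k ∷ p)) → k < m
  down-< {m} {k} w = ℕₚ.<ᵇ⇒< k m (proj₁ (to (T-∧ {k <ᵇ m}) (proj₂ (to (T-∧ {m ≤ᵇ L}) w))))

  down-rest : ∀ {m k p} → T (isWalk m false (D k ∷ p)) → T (isWalk (m ∸ suc k) true p)
  down-rest {m} {k} w = proj₂ (to (T-∧ {k <ᵇ m}) (proj₂ (to (T-∧ {m ≤ᵇ L}) w)))

  -- k ↦ m ∸ suc k exchanges the size of a down-step from height m with its landing height.
  reflect-< : ∀ {k m} → k < m → m ∸ suc k < m
  reflect-< {k} {suc m} _ = s≤s (ℕₚ.m∸n≤m m k)

  reflect-involutive : ∀ {k m} → k < m → m ∸ suc (m ∸ suc k) ≡ k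
  reflect-involutive {m = suc m} (s≤s k≤m) = ℕₚ.m∸[m∸n]≡n k≤m

  module _ {m n : ℕ} (m≤L : T (m ≤ᵇ L)) where

    splitFirst : ∀ f → Walk m f (suc n) → Walk (suc m) false n ⊎ DownWalk m f n
    splitFirst f     ([] , () , _)
    splitFirst f     (U ∷ p , l , w)   = inj₁ (p , ℕₚ.suc-injective l , up-rest {m} {f} {p} w)
    splitFirst true  (D k ∷ p , l , ())
    splitFirst false (D k ∷ p , l , w) =
      inj₂ (m ∸ suc k , reflect-< (down-< {m} {k} {p} w) , p , ℕₚ.suc-injective l , down-rest {m} {k} {p} w)

    joinFirst : ∀ f → Walk (suc m) false n ⊎ DownWalk m f n → Walk m f (suc n)
    joinFirst f     (inj₁ (p , l , w))           = U ∷ p , cong suc l , from T-∧ (m≤L , w)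
    joinFirst false (inj₂ (j , j<m , p , l , w)) =
      D (m ∸ suc j) ∷ p , cong suc l ,
      from T-∧ (m≤L , from T-∧ (ℕₚ.<⇒<ᵇ (reflect-< j<m) ,
                                subst (λ i → T (isWalk i true p)) (sym (reflect-involutive j<m)) w))

    split-join : ∀ f x → splitFirst f (joinFirst f x) ≡ x
    split-join f     (inj₁ _)                = cong inj₁ (walk-≡ refl)
    split-join false (inj₂ (j , j<m , _))    = cong inj₂ (walkBelow-≡ (reflect-involutive j<m) refl)

    join-split : ∀ f w → joinFirst f (splitFirst f w) ≡ w
    join-split f     ([] , () , _)
    join-split f     (U ∷ p , _)       = walk-≡ refl
    join-split true  (D k ∷ p , l , ())
    join-split false (D k ∷ p , l , w) = walk-≡ (cong (λ i → D i ∷ p) (reflect-involutive (down-< {m} {k} {p} w)))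

    firstStep↔ : ∀ f → Walk m f (suc n) ↔ (Walk (suc m) false n ⊎ DownWalk m f n)
    firstStep↔ f = mk↔ₛ′ (splitFirst f) (joinFirst f) (split-join f) (join-split f)

  module _ (b n : ℕ) where

    splitBelow : WalkBelow (suc b) n → Walk b true n ⊎ WalkBelow b n
    splitBelow (j , j<1+b , w) with j ℕₚ.≟ b
    ... | yes refl = inj₁ w
    ... | no j≢b   = inj₂ (j , ℕₚ.≤∧≢⇒< (ℕₚ.≤-pred j<1+b) j≢b , w)

    joinBelow : Walk b true n ⊎ WalkBelow b n → WalkBelow (suc b) n
    joinBelow (inj₁ w)             = b , ℕₚ.n<1+n b , w
    joinBelow (inj₂ (j , j<b , w)) = j , ℕₚ.m<n⇒m<1+n j<b , w

    split-joinBelow : ∀ x → splitBelow (joinBelow x) ≡ x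
    split-joinBelow (inj₁ w) with b ℕₚ.≟ b
    ... | yes refl = refl
    ... | no b≢b   = ⊥-elim (b≢b refl)
    split-joinBelow (inj₂ (j , j<b , w)) with j ℕₚ.≟ b
    ... | yes refl = ⊥-elim (ℕₚ.<-irrefl refl j<b)
    ... | no _     = cong inj₂ (walkBelow-≡ refl refl)

    join-splitBelow : ∀ x → joinBelow (splitBelow x) ≡ x
    join-splitBelow (j , _ , _) with j ℕₚ.≟ b
    ... | yes refl = walkBelow-≡ refl refl
    ... | no _     = walkBelow-≡ refl refl

    below-suc↔ : WalkBelow (suc b) n ↔ (Walk b true n ⊎ WalkBelow b n)
    below-suc↔ = mk↔ₛ′ splitBelow joinBelow split-joinBelow join-splitBelow

  below-zero↔ : ∀ n → WalkBelow 0 n ↔ ⊥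
  below-zero↔ n = mk↔ₛ′ (λ { (_ , () , _) }) (λ ()) (λ ()) (λ { (_ , () , _) })

  empty↔ : ∀ m f → Walk m f 0 ↔ T ((m ≤ᵇ L) ∧ (m ≡ᵇ target))
  empty↔ m f = mk↔ₛ′ (λ { ([] , _ , w) → w }) (λ w → [] , refl , w) (λ _ → refl)
                     (λ { ([] , refl , w) → refl })

  outside↔ : ∀ {m} f n → (m ≤ᵇ L) ≡ false → Walk m f n ↔ ⊥
  outside↔ {m} f n m>L =
    mk↔ₛ′ (λ w → outside f (proj₁ w) (proj₂ (proj₂ w))) (λ ()) (λ ())
          (λ w → ⊥-elim (outside f (proj₁ w) (proj₂ (proj₂ w))))
    where
    outside : ∀ f p → T (isWalk m f p) → ⊥
    outside f     []        w = subst T m>L (proj₁ (to T-∧ w))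
    outside f     (U ∷ p)   w = subst T m>L (proj₁ (to T-∧ w))
    outside true  (D k ∷ p) ()
    outside false (D k ∷ p) w = subst T m>L (proj₁ (to T-∧ w))

  if↔T : ∀ b → Fin (if b then 1 else 0) ↔ T b
  if↔T true  = Finₚ.1↔⊤
  if↔T false = Finₚ.0↔⊥

  count↔Walk : ∀ n m f → Fin (count m f n) ↔ Walk m f n
  count↔Walk zero    m f = ↔-trans (if↔T ((m ≤ᵇ L) ∧ (m ≡ᵇ target))) (↔-sym (empty↔ m f))
  count↔Walk (suc n) m f with m ≤ᵇ L in m≤L
  ... | false = ↔-trans Finₚ.0↔⊥ (↔-sym (outside↔ f (suc n) m≤L))
  ... | true  = ↔-trans (Finₚ.+↔⊎ {count (suc m) false n} {countDown m f n})
                  (↔-trans (count↔Walk n (suc m) false ⊎-↔ countDown↔ f)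
                           (↔-sym (firstStep↔ (subst T (sym m≤L) tt) f)))
    where
    countBelow↔ : ∀ b → Fin (countBelow b n) ↔ WalkBelow b n
    countBelow↔ zero    = ↔-trans Finₚ.0↔⊥ (↔-sym (below-zero↔ n))
    countBelow↔ (suc b) = ↔-trans (Finₚ.+↔⊎ {count b true n} {countBelow b n})
                            (↔-trans (count↔Walk n b true ⊎-↔ countBelow↔ b) (↔-sym (below-suc↔ b n)))

    countDown↔ : ∀ f → Fin (countDown m f n) ↔ DownWalk m f n
    countDown↔ true  = Finₚ.0↔⊥
    countDown↔ false = countBelow↔ m

-- Bounded GDAP are the walks in the strip [0, 2t] from height t to t

T-ext : ∀ {a b} → (T a → T b) → (T b → T a) → a ≡ b
T-ext {false} {false} _ _ = refl
T-ext {false} {true}  _ g = ⊥-elim (g tt)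
T-ext {true}  {false} f _ = ⊥-elim (f tt)
T-ext {true}  {true}  _ _ = refl

afterDown : List Step → Bool
afterDown []        = true
afterDown (U ∷ p)   = noConsecDown p
afterDown (D _ ∷ _) = false

noConsecDownAfter : Bool → List Step → Bool
noConsecDownAfter false = noConsecDown
noConsecDownAfter true  = afterDown

noConsecDown-D : ∀ k p → noConsecDown (D k ∷ p) ≡ afterDown p
noConsecDown-D k []      = refl
noConsecDown-D k (U ∷ p) = refl
noConsecDown-D k (D j ∷ p) = refl

module _ (t : ℕ) where
  open Strip (t + t) t using (isWalk)
  open ℤSolver.+-*-Solver

  height : ℕ → ℤ
  height m = + m ℤ.- + t

  inBand-height : ∀ m → inBand t (height m) ≡ (m ≤ᵇ t + t)
  inBand-height m = T-ext
    (λ w → ℕₚ.≤⇒≤ᵇ (height≤t⇒ (ℤₚ.≤ᵇ⇒≤ (proj₂ (to (T-∧ {ℤ.- (+ t) ℤ.≤ᵇ height m}) w)))))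
    (λ w → from T-∧ (ℤₚ.≤⇒≤ᵇ -t≤height , ℤₚ.≤⇒≤ᵇ (⇒height≤t (ℕₚ.≤ᵇ⇒≤ m (t + t) w))))
    where
    -t≤height : ℤ.- (+ t) ℤ.≤ height m
    -t≤height = subst (ℤ._≤ height m) (ℤₚ.+-identityˡ (ℤ.- (+ t))) (ℤₚ.+-monoˡ-≤ (ℤ.- (+ t)) (ℤ.+≤+ z≤n))

    ⇒height≤t : m ≤ t + t → height m ℤ.≤ + t
    ⇒height≤t m≤2t = subst (height m ℤ.≤_) (solve 1 (λ a → (a :+ a) :- a := a) refl (+ t))
                           (ℤₚ.+-monoˡ-≤ (ℤ.- (+ t)) (ℤ.+≤+ m≤2t))

    height≤t⇒ : height m ℤ.≤ + t → m ≤ t + t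
    height≤t⇒ h≤t with subst (ℤ._≤ + t ℤ.+ + t) (solve 2 (λ a b → (a :- b) :+ b := a) refl (+ m) (+ t))
                              (ℤₚ.+-monoˡ-≤ (+ t) h≤t)
    ... | ℤ.+≤+ m≤2t = m≤2t

  isZero-height : ∀ m → isZero (height m) ≡ (m ≡ᵇ t)
  isZero-height m = T-ext
    (λ z → ℕₚ.≡⇒≡ᵇ m t (ℤₚ.+-injective (begin
      + m                ≡⟨ solve 2 (λ a b → a := (a :- b) :+ b) refl (+ m) (+ t) ⟩
      height m ℤ.+ + t   ≡⟨ cong (ℤ._+ + t) (isZero⇒≡0 (height m) z) ⟩
      + t                ∎)))
    (λ m≡t → subst (λ i → T (isZero (+ i ℤ.- + t))) (sym (ℕₚ.≡ᵇ⇒≡ m t m≡t))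
                   (subst (T ∘ isZero) (sym (ℤₚ.+-inverseʳ (+ t))) tt))
    where
    open ≡-Reasoning
    isZero⇒≡0 : ∀ h → T (isZero h) → h ≡ + 0
    isZero⇒≡0 (+ zero) _ = refl

  height-up : ∀ m → height m ℤ.+ + 1 ≡ height (suc m)
  height-up m = solve 2 (λ a b → (a :- b) :+ con (+ 1) := (con (+ 1) :+ a) :- b) refl (+ m) (+ t)

  height-down : ∀ m k → k < m → height m ℤ.+ -[1+ k ] ≡ height (m ∸ suc k)
  height-down m k k<m = trans (solve 3 (λ a b c → (a :- b) :+ c := (a :+ c) :- b) refl (+ m) (+ t) -[1+ k ])
                              (cong (ℤ._- + t) (ℤₚ.⊖-≥ k<m))

  inBand-fall : ∀ m k → m ≤ k → inBand t (height m ℤ.+ -[1+ k ]) ≡ false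
  inBand-fall m k m≤k =
    T-ext (λ w → below (ℤₚ.≤ᵇ⇒≤ (proj₁ (to (T-∧ {ℤ.- (+ t) ℤ.≤ᵇ (height m ℤ.+ -[1+ k ])}) w)))) λ ()
    where
    below : ℤ.- (+ t) ℤ.≤ height m ℤ.+ -[1+ k ] → ⊥
    below -t≤h with subst₂ ℤ._≤_ (solve 1 (λ a → :- a :+ a := con (+ 0)) refl (+ t))
                     (trans (solve 3 (λ a b c → ((a :- b) :+ c) :+ b := a :+ c) refl (+ m) (+ t) -[1+ k ])
                            (trans (ℤₚ.⊖-< (s≤s m≤k)) (cong (λ i → ℤ.- (+ i)) (ℕₚ.+-∸-assoc 1 m≤k))))
                     (ℤₚ.+-monoˡ-≤ (+ t) -t≤h)
    ... | ()

  bandWalk-outside : ∀ h p → inBand t h ≡ false → bandWalk t h p ≡ false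
  bandWalk-outside h []      out rewrite out = refl
  bandWalk-outside h (s ∷ p) out rewrite out = refl

  isWalk≡bandWalk : ∀ p m f → isWalk m f p ≡ noConsecDownAfter f p ∧ bandWalk t (height m) p
  isWalk≡bandWalk []        m false rewrite inBand-height m | isZero-height m = refl
  isWalk≡bandWalk []        m true  rewrite inBand-height m | isZero-height m = refl
  isWalk≡bandWalk (U ∷ p)   m false rewrite inBand-height m | height-up m | isWalk≡bandWalk p (suc m) false =
    x∙yz≈y∙xz (m ≤ᵇ t + t) (noConsecDown p) _
  isWalk≡bandWalk (U ∷ p)   m true  rewrite inBand-height m | height-up m | isWalk≡bandWalk p (suc m) false =
    x∙yz≈y∙xz (m ≤ᵇ t + t) (noConsecDown p) _
  isWalk≡bandWalk (D k ∷ p) m true  = refl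
  isWalk≡bandWalk (D k ∷ p) m false rewrite noConsecDown-D k p | inBand-height m with k <ᵇ m in k<ᵇm
  ... | true  rewrite height-down m k (ℕₚ.<ᵇ⇒< k m (subst T (sym k<ᵇm) tt))
                    | isWalk≡bandWalk p (m ∸ suc k) true = x∙yz≈y∙xz (m ≤ᵇ t + t) (afterDown p) _
  ... | false rewrite bandWalk-outside (height m ℤ.+ -[1+ k ]) p
                        (inBand-fall m k (ℕₚ.≮⇒≥ (λ k<m → subst T k<ᵇm (ℕₚ.<⇒<ᵇ k<m))))
                    | ∧-zeroʳ (m ≤ᵇ t + t) | ∧-zeroʳ (afterDown p) = refl

  isBoundedGDAP≡isWalk : ∀ p → isBoundedGDAP t p ≡ isWalk t false p
  isBoundedGDAP≡isWalk p =
    sym (trans (isWalk≡bandWalk p t false) (cong (λ h → noConsecDown p ∧ bandWalk t h p) (ℤₚ.+-inverseʳ (+ t))))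

-- The ring of formal power series

infixl 7 _⊛′_
_⊛′_ : PS → PS → PS
(f ⊛′ g) zero    = f 0 ℚ.* g 0
(f ⊛′ g) (suc n) = f 0 ℚ.* g (suc n) ℚ.+ ((f ∘ suc) ⊛′ g) n

⊛≈⊛′ : ∀ f g → f ⊛ g ≈ f ⊛′ g
⊛≈⊛′ f g n =
  trans (cong sumℚ (map-upTo (λ i → f i ℚ.* g (n ∸ i)) (suc n))) (sum≡⊛′ n f)
  where
  sum≡⊛′ : ∀ n f → sumℚ (applyUpTo (λ i → f i ℚ.* g (n ∸ i)) (suc n)) ≡ (f ⊛′ g) n
  sum≡⊛′ zero    f = ℚₚ.+-identityʳ _
  sum≡⊛′ (suc n) f = cong (f 0 ℚ.* g (suc n) ℚ.+_) (sum≡⊛′ n (f ∘ suc))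

zeroₚ : PS
zeroₚ = const ℚ.0ℚ

scale : ℚ → PS → PS
scale c f n = c ℚ.* f n

⊛′-cong : ∀ {f f′ g g′} → f ≈ f′ → g ≈ g′ → f ⊛′ g ≈ f′ ⊛′ g′
⊛′-cong f≈f′ g≈g′ zero    = cong₂ ℚ._*_ (f≈f′ 0) (g≈g′ 0)
⊛′-cong f≈f′ g≈g′ (suc n) =
  cong₂ ℚ._+_ (cong₂ ℚ._*_ (f≈f′ 0) (g≈g′ (suc n))) (⊛′-cong (f≈f′ ∘ suc) g≈g′ n)

⊛′-zeroˡ : ∀ g → (λ _ → ℚ.0ℚ) ⊛′ g ≈ λ _ → ℚ.0ℚ
⊛′-zeroˡ g zero    = ℚₚ.*-zeroˡ (g 0)
⊛′-zeroˡ g (suc n) = trans (cong₂ ℚ._+_ (ℚₚ.*-zeroˡ (g (suc n))) (⊛′-zeroˡ g n)) (ℚₚ.+-identityʳ _)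

const-⊛′ : ∀ c g → const c ⊛′ g ≈ scale c g
const-⊛′ c g zero    = refl
const-⊛′ c g (suc n) = trans (cong (c ℚ.* g (suc n) ℚ.+_) (⊛′-zeroˡ g n)) (ℚₚ.+-identityʳ _)

X⊛-zero : ∀ F → (X ⊛ F) 0 ≡ ℚ.0ℚ
X⊛-zero F = trans (⊛≈⊛′ X F 0) (ℚₚ.*-zeroˡ (F 0))

X⊛-suc : ∀ F n → (X ⊛ F) (suc n) ≡ F n
X⊛-suc F n = begin
  (X ⊛ F) (suc n)                           ≡⟨ ⊛≈⊛′ X F (suc n) ⟩
  ℚ.0ℚ ℚ.* F (suc n) ℚ.+ ((X ∘ suc) ⊛′ F) n ≡⟨ cong₂ ℚ._+_ (ℚₚ.*-zeroˡ (F (suc n)))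
                                                           (⊛′-cong X∘suc≈one (λ _ → refl) n) ⟩
  ℚ.0ℚ ℚ.+ (one ⊛′ F) n                     ≡⟨ ℚₚ.+-identityˡ _ ⟩
  (one ⊛′ F) n                              ≡⟨ const-⊛′ 1ℚ F n ⟩
  1ℚ ℚ.* F n                                ≡⟨ ℚₚ.*-identityˡ (F n) ⟩
  F n                                       ∎
  where
  open ≡-Reasoning
  X∘suc≈one : X ∘ suc ≈ one
  X∘suc≈one zero    = refl
  X∘suc≈one (suc n) = refl

scale-⊛′ : ∀ c f g → scale c f ⊛′ g ≈ scale c (f ⊛′ g)
scale-⊛′ c f g zero    = ℚₚ.*-assoc c (f 0) (g 0)
scale-⊛′ c f g (suc n) =
  trans (cong₂ ℚ._+_ (ℚₚ.*-assoc c (f 0) (g (suc n))) (scale-⊛′ c (f ∘ suc) g n))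
        (sym (ℚₚ.*-distribˡ-+ c _ _))

module _ where
  open ℚSolver.+-*-Solver

  ⊛′-distribˡ : ∀ f g h → f ⊛′ (g ⊕ h) ≈ f ⊛′ g ⊕ f ⊛′ h
  ⊛′-distribˡ f g h zero    = ℚₚ.*-distribˡ-+ (f 0) (g 0) (h 0)
  ⊛′-distribˡ f g h (suc n) =
    trans (cong₂ ℚ._+_ (ℚₚ.*-distribˡ-+ (f 0) (g (suc n)) (h (suc n))) (⊛′-distribˡ (f ∘ suc) g h n))
          (solve 4 (λ a b c d → (a :+ b) :+ (c :+ d) := (a :+ c) :+ (b :+ d)) refl
            (f 0 ℚ.* g (suc n)) (f 0 ℚ.* h (suc n)) (((f ∘ suc) ⊛′ g) n) (((f ∘ suc) ⊛′ h) n))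

  ⊛′-distribʳ : ∀ f g h → (f ⊕ g) ⊛′ h ≈ f ⊛′ h ⊕ g ⊛′ h
  ⊛′-distribʳ f g h zero    = ℚₚ.*-distribʳ-+ (h 0) (f 0) (g 0)
  ⊛′-distribʳ f g h (suc n) =
    trans (cong₂ ℚ._+_ (ℚₚ.*-distribʳ-+ (h (suc n)) (f 0) (g 0)) (⊛′-distribʳ (f ∘ suc) (g ∘ suc) h n))
          (solve 4 (λ a b c d → (a :+ b) :+ (c :+ d) := (a :+ c) :+ (b :+ d)) refl
            (f 0 ℚ.* h (suc n)) (g 0 ℚ.* h (suc n)) (((f ∘ suc) ⊛′ h) n) (((g ∘ suc) ⊛′ h) n))

  ⊛′-unfoldʳ : ∀ f g n → (f ⊛′ g) (suc n) ≡ g 0 ℚ.* f (suc n) ℚ.+ (f ⊛′ (g ∘ suc)) n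
  ⊛′-unfoldʳ f g zero    =
    solve 4 (λ a b c d → a :* b :+ c :* d := d :* c :+ a :* b) refl (f 0) (g 1) (f 1) (g 0)
  ⊛′-unfoldʳ f g (suc n) =
    trans (cong (f 0 ℚ.* g (suc (suc n)) ℚ.+_) (⊛′-unfoldʳ (f ∘ suc) g n))
          (solve 3 (λ a b c → a :+ (b :+ c) := b :+ (a :+ c)) refl
            (f 0 ℚ.* g (suc (suc n))) (g 0 ℚ.* f (suc (suc n))) (((f ∘ suc) ⊛′ (g ∘ suc)) n))

  ⊛′-comm : ∀ f g → f ⊛′ g ≈ g ⊛′ f
  ⊛′-comm f g zero    = ℚₚ.*-comm (f 0) (g 0)
  ⊛′-comm f g (suc n) = trans (⊛′-unfoldʳ f g n) (cong (g 0 ℚ.* f (suc n) ℚ.+_) (⊛′-comm f (g ∘ suc) n))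

  -- (f ⊛′ g) ∘ suc is, pointwise and definitionally, scale (f 0) (g ∘ suc) ⊕ (f ∘ suc) ⊛′ g.
  ⊛′-assoc : ∀ f g h → (f ⊛′ g) ⊛′ h ≈ f ⊛′ (g ⊛′ h)
  ⊛′-assoc f g h zero    = ℚₚ.*-assoc (f 0) (g 0) (h 0)
  ⊛′-assoc f g h (suc n) = begin
    (f 0 ℚ.* g 0) ℚ.* h (suc n) ℚ.+ ((scale (f 0) (g ∘ suc) ⊕ (f ∘ suc) ⊛′ g) ⊛′ h) n
      ≡⟨ cong ((f 0 ℚ.* g 0) ℚ.* h (suc n) ℚ.+_) (⊛′-distribʳ (scale (f 0) (g ∘ suc)) ((f ∘ suc) ⊛′ g) h n) ⟩
    (f 0 ℚ.* g 0) ℚ.* h (suc n) ℚ.+ ((scale (f 0) (g ∘ suc) ⊛′ h) n ℚ.+ (((f ∘ suc) ⊛′ g) ⊛′ h) n)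
      ≡⟨ cong ((f 0 ℚ.* g 0) ℚ.* h (suc n) ℚ.+_)
              (cong₂ ℚ._+_ (scale-⊛′ (f 0) (g ∘ suc) h n) (⊛′-assoc (f ∘ suc) g h n)) ⟩
    (f 0 ℚ.* g 0) ℚ.* h (suc n) ℚ.+ (f 0 ℚ.* ((g ∘ suc) ⊛′ h) n ℚ.+ ((f ∘ suc) ⊛′ (g ⊛′ h)) n)
      ≡⟨ solve 5 (λ a b c d e → (a :* b) :* c :+ (a :* d :+ e) := a :* (b :* c :+ d) :+ e) refl
         (f 0) (g 0) (h (suc n)) (((g ∘ suc) ⊛′ h) n) (((f ∘ suc) ⊛′ (g ⊛′ h)) n) ⟩
    f 0 ℚ.* (g 0 ℚ.* h (suc n) ℚ.+ ((g ∘ suc) ⊛′ h) n) ℚ.+ ((f ∘ suc) ⊛′ (g ⊛′ h)) n ∎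
    where open ≡-Reasoning

⊛-via-⊛′ : ∀ {f g h k} → f ⊛′ g ≈ h ⊛′ k → f ⊛ g ≈ h ⊛ k
⊛-via-⊛′ {f} {g} {h} {k} eq n = trans (⊛≈⊛′ f g n) (trans (eq n) (sym (⊛≈⊛′ h k n)))

-- Wrapping ≈ in a record keeps the two series recoverable from the type of
-- a proof, so that the ring lemmas can infer them.
infix 4 _≋_
record _≋_ (f g : PS) : Set where
  constructor mk
  field un : f ≈ g
open _≋_ public

neg : PS → PS
neg f n = ℚ.- f n

≋-isEquivalence : IsEquivalence _≋_
≋-isEquivalence = record
  { refl  = mk (λ n → refl)
  ; sym   = λ p → mk (λ n → sym (un p n))
  ; trans = λ p q → mk (λ n → trans (un p n) (un q n))
  }

zeroₚ≡0 : ∀ n → zeroₚ n ≡ ℚ.0ℚ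
zeroₚ≡0 zero    = refl
zeroₚ≡0 (suc n) = refl

powerSeriesRing : CommutativeRing _ _
powerSeriesRing = record
  { Carrier = PS ; _≈_ = _≋_ ; _+_ = _⊕_ ; _*_ = _⊛_ ; -_ = neg ; 0# = zeroₚ ; 1# = one
  ; isCommutativeRing = record
    { isRing = record
      { +-isAbelianGroup = record
        { isGroup = record
          { isMonoid = record
            { isSemigroup = record
              { isMagma = record
                { isEquivalence = ≋-isEquivalence
                ; ∙-cong = λ p q → mk (λ n → cong₂ ℚ._+_ (un p n) (un q n)) }
              ; assoc = λ f g h → mk (λ n → ℚₚ.+-assoc (f n) (g n) (h n)) }
            ; identity = (λ f → mk (λ n → trans (cong (ℚ._+ f n) (zeroₚ≡0 n)) (ℚₚ.+-identityˡ (f n))))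
                       , (λ f → mk (λ n → trans (cong (f n ℚ.+_) (zeroₚ≡0 n)) (ℚₚ.+-identityʳ (f n)))) }
          ; inverse = (λ f → mk (λ n → trans (ℚₚ.+-inverseˡ (f n)) (sym (zeroₚ≡0 n))))
                    , (λ f → mk (λ n → trans (ℚₚ.+-inverseʳ (f n)) (sym (zeroₚ≡0 n))))
          ; ⁻¹-cong = λ p → mk (λ n → cong ℚ.-_ (un p n)) }
        ; comm = λ f g → mk (λ n → ℚₚ.+-comm (f n) (g n)) }
      ; *-cong = λ p q → mk (⊛-via-⊛′ (⊛′-cong (un p) (un q)))
      ; *-assoc = λ f g h → mk (⊛-via-⊛′ {f ⊛ g} {h} {f} {g ⊛ h} (λ n → begin
          ((f ⊛ g) ⊛′ h) n ≡⟨ ⊛′-cong (⊛≈⊛′ f g) (λ _ → refl) n ⟩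
          ((f ⊛′ g) ⊛′ h) n ≡⟨ ⊛′-assoc f g h n ⟩
          (f ⊛′ (g ⊛′ h)) n ≡⟨ ⊛′-cong {f} (λ _ → refl) (λ k → sym (⊛≈⊛′ g h k)) n ⟩
          (f ⊛′ (g ⊛ h)) n ∎))
      ; *-identity = (λ f → mk (λ n → trans (⊛≈⊛′ one f n) (trans (const-⊛′ 1ℚ f n) (ℚₚ.*-identityˡ (f n)))))
                   , (λ f → mk (λ n → trans (⊛-via-⊛′ (⊛′-comm f one) n)
                        (trans (⊛≈⊛′ one f n) (trans (const-⊛′ 1ℚ f n) (ℚₚ.*-identityˡ (f n))))))
      ; distrib = (λ f g h → mk (λ n → trans (⊛≈⊛′ f (g ⊕ h) n) (trans (⊛′-distribˡ f g h n)
                    (sym (cong₂ ℚ._+_ (⊛≈⊛′ f g n) (⊛≈⊛′ f h n))))))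
                , (λ h f g → mk (λ n → trans (⊛≈⊛′ (f ⊕ g) h n) (trans (⊛′-distribʳ f g h n)
                    (sym (cong₂ ℚ._+_ (⊛≈⊛′ f h n) (⊛≈⊛′ g h n)))))) }
    ; *-comm = λ f g → mk (⊛-via-⊛′ (⊛′-comm f g)) } }
  where open ≡-Reasoning

toℚ : ℤ → ℚ
toℚ z = z / 1

-- z / 1 is the normal form mkℚ z 0 _, on which the operations of ℚ compute.
toℚ≡mkℚ : ∀ z → toℚ z ≡ ℚ.mkℚ z 0 (Coprimality.sym (Coprimality.1-coprimeTo ℤ.∣ z ∣))
toℚ≡mkℚ (+ n)    = ℚₚ.normalize-coprime (Coprimality.sym (Coprimality.1-coprimeTo n))
toℚ≡mkℚ -[1+ n ] = cong ℚ.-_ (ℚₚ.normalize-coprime (Coprimality.sym (Coprimality.1-coprimeTo (suc n))))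

toℚ-+ : ∀ a b → toℚ (a ℤ.+ b) ≡ toℚ a ℚ.+ toℚ b
toℚ-+ a b = trans (cong toℚ (sym (cong₂ ℤ._+_ (ℤₚ.*-identityʳ a) (ℤₚ.*-identityʳ b))))
                  (sym (cong₂ ℚ._+_ (toℚ≡mkℚ a) (toℚ≡mkℚ b)))

toℚ-* : ∀ a b → toℚ (a ℤ.* b) ≡ toℚ a ℚ.* toℚ b
toℚ-* a b = sym (cong₂ ℚ._*_ (toℚ≡mkℚ a) (toℚ≡mkℚ b))

toℚ-neg : ∀ a → toℚ (ℤ.- a) ≡ ℚ.- toℚ a
toℚ-neg a = trans (toℚ≡mkℚ (ℤ.- a)) (trans (mkℚ-neg a) (cong ℚ.-_ (sym (toℚ≡mkℚ a))))
  where
  mkℚ-neg : ∀ a → ℚ.mkℚ (ℤ.- a) 0 (Coprimality.sym (Coprimality.1-coprimeTo ℤ.∣ ℤ.- a ∣))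
                ≡ ℚ.- ℚ.mkℚ a 0 (Coprimality.sym (Coprimality.1-coprimeTo ℤ.∣ a ∣))
  mkℚ-neg (+ zero)  = refl
  mkℚ-neg (+ suc n) = refl
  mkℚ-neg -[1+ n ]  = refl

ℤc-+ : ∀ a b → ℤc (a ℤ.+ b) ≋ ℤc a ⊕ ℤc b
ℤc-+ a b = mk λ { zero → toℚ-+ a b ; (suc n) → sym (ℚₚ.+-identityʳ ℚ.0ℚ) }

ℤc-* : ∀ a b → ℤc (a ℤ.* b) ≋ ℤc a ⊛ ℤc b
ℤc-* a b = mk (λ n → trans (coefficient n) (sym (trans (⊛≈⊛′ (ℤc a) (ℤc b) n) (const-⊛′ (toℚ a) (ℤc b) n))))
  where
  coefficient : ∀ n → ℤc (a ℤ.* b) n ≡ toℚ a ℚ.* ℤc b n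
  coefficient zero    = toℚ-* a b
  coefficient (suc n) = sym (ℚₚ.*-zeroʳ (toℚ a))

ℤc-neg : ∀ a → ℤc (ℤ.- a) ≋ neg (ℤc a)
ℤc-neg a = mk λ { zero → toℚ-neg a ; (suc n) → refl }

2^[t+2]*[-1]^t*[-2]^t≡4*4^t : ∀ t → + (2 ^ (t + 2)) *ℤ (-[1+ 0 ] ^ℤ t) *ℤ (-[1+ 1 ] ^ℤ t) ≡ + 4 *ℤ ((+ 4) ^ℤ t)
2^[t+2]*[-1]^t*[-2]^t≡4*4^t zero    = refl
2^[t+2]*[-1]^t*[-2]^t≡4*4^t (suc t) = begin
  + (2 * 2 ^ (t + 2)) *ℤ (-[1+ 0 ] *ℤ a) *ℤ (-[1+ 1 ] *ℤ b)
    ≡⟨ cong (λ z → z *ℤ (-[1+ 0 ] *ℤ a) *ℤ (-[1+ 1 ] *ℤ b)) (ℤₚ.pos-* 2 (2 ^ (t + 2))) ⟩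
  + 2 *ℤ + (2 ^ (t + 2)) *ℤ (-[1+ 0 ] *ℤ a) *ℤ (-[1+ 1 ] *ℤ b)
    ≡⟨ solve 3 (λ p a b → con (+ 2) :* p :* (con -[1+ 0 ] :* a) :* (con -[1+ 1 ] :* b)
                       := con (+ 4) :* (p :* a :* b)) refl (+ (2 ^ (t + 2))) a b ⟩
  + 4 *ℤ (+ (2 ^ (t + 2)) *ℤ a *ℤ b)
    ≡⟨ cong (+ 4 *ℤ_) (2^[t+2]*[-1]^t*[-2]^t≡4*4^t t) ⟩
  + 4 *ℤ (+ 4 *ℤ ((+ 4) ^ℤ t)) ∎
  where
  open ≡-Reasoning
  open ℤSolver.+-*-Solver
  a b : ℤ
  a = -[1+ 0 ] ^ℤ t
  b = -[1+ 1 ] ^ℤ t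

module R = CommutativeRing powerSeriesRing
open Exp R.commutativeSemiring using (^-homo-*; ^-distrib-*; ^-congˡ) renaming (_^_ to _^ᴿ_)
open import Relation.Binary.Reasoning.Setoid R.setoid

⊛-congˡ : ∀ f {g g′} → g ≋ g′ → f ⊛ g ≋ f ⊛ g′
⊛-congˡ f = R.*-congˡ {f}

⊛-congʳ : ∀ g {f f′} → f ≋ f′ → f ⊛ g ≋ f′ ⊛ g
⊛-congʳ g = R.*-congʳ {g}

⊖-cong : ∀ {f f′ g g′} → f ≋ f′ → g ≋ g′ → f ⊖ g ≋ f′ ⊖ g′
⊖-cong p q = mk (λ n → cong₂ ℚ._-_ (un p n) (un q n))

⊖-congˡ : ∀ f {g g′} → g ≋ g′ → f ⊖ g ≋ f ⊖ g′
⊖-congˡ f = ⊖-cong (R.refl {f})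

⊕-congˡ : ∀ f {g g′} → g ≋ g′ → f ⊕ g ≋ f ⊕ g′
⊕-congˡ f = R.+-congˡ {f}

⊕-congʳ : ∀ g {f f′} → f ≋ f′ → f ⊕ g ≋ f′ ⊕ g
⊕-congʳ g = R.+-congʳ {g}

-- The ring's power agrees with _^ₚ_ only propositionally for a variable exponent.
^ₚ≡^ᴿ : ∀ f t → f ^ₚ t ≡ f ^ᴿ t
^ₚ≡^ᴿ f zero    = refl
^ₚ≡^ᴿ f (suc t) = cong (f ⊛_) (^ₚ≡^ᴿ f t)

^ₚ-congˡ : ∀ t {f g} → f ≋ g → f ^ₚ t ≋ g ^ₚ t
^ₚ-congˡ t {f} {g} rewrite ^ₚ≡^ᴿ f t | ^ₚ≡^ᴿ g t = ^-congˡ t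

^ₚ-homo-⊛ : ∀ f m n → f ^ₚ (m + n) ≋ f ^ₚ m ⊛ f ^ₚ n
^ₚ-homo-⊛ f m n rewrite ^ₚ≡^ᴿ f (m + n) | ^ₚ≡^ᴿ f m | ^ₚ≡^ᴿ f n = ^-homo-* f m n

^ₚ-distrib-⊛ : ∀ f g t → (f ⊛ g) ^ₚ t ≋ f ^ₚ t ⊛ g ^ₚ t
^ₚ-distrib-⊛ f g t rewrite ^ₚ≡^ᴿ (f ⊛ g) t | ^ₚ≡^ᴿ f t | ^ₚ≡^ᴿ g t = ^-distrib-* f g t

ℤc-^ : ∀ a n → ℤc (a ^ℤ n) ≋ ℤc a ^ₚ n
ℤc-^ a zero    = R.refl
ℤc-^ a (suc n) = R.trans (ℤc-* a (a ^ℤ n)) (⊛-congˡ (ℤc a) (ℤc-^ a n))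

ℤ→PS : CommutativeRing.rawRing ℤₚ.+-*-commutativeRing
         -Raw-AlmostCommutative⟶ fromCommutativeRing powerSeriesRing
ℤ→PS = record
  { ⟦_⟧ = ℤc ; +-homo = ℤc-+ ; *-homo = ℤc-* ; -‿homo = ℤc-neg
  ; 0-homo = mk (λ _ → refl) ; 1-homo = mk (λ _ → refl) }

ℤc-≟ : ∀ a b → Maybe (ℤc a ≋ ℤc b)
ℤc-≟ a b with a ℤ.≟ b
... | yes refl = just R.refl
... | no _     = nothing

open RingSolver (CommutativeRing.rawRing ℤₚ.+-*-commutativeRing)
                (fromCommutativeRing powerSeriesRing) ℤ→PS ℤc-≟

residual : (ℕ → PS) → ℕ → PS
residual u m = u (suc (suc m)) ⊕ A ⊛ u (suc m) ⊕ X ⊛ u m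

residual-step : ∀ u m → u (suc (suc m)) ≋ residual u m ⊖ A ⊛ u (suc m) ⊖ X ⊛ u m
residual-step u m =
  solve 5 (λ α x u₀ u₁ u₂ → u₂ := (u₂ :+ α :* u₁ :+ x :* u₀) :- α :* u₁ :- x :* u₀)
        R.refl A X (u m) (u (suc m)) (u (suc (suc m)))

residual-unique : ∀ {u v} n → (∀ m → suc (suc m) ≤ n → residual u m ≋ residual v m) →
                  u 0 ≋ v 0 → u 1 ≋ v 1 → u n ≋ v n
residual-unique zero            _    u₀≋v₀ _     = u₀≋v₀
residual-unique {u} {v} (suc n) same u₀≋v₀ u₁≋v₁ = proj₂ (agree n ℕₚ.≤-refl)
  where
  agree : ∀ k → k ≤ n → u k ≋ v k × u (suc k) ≋ v (suc k)
  agree zero    _   = u₀≋v₀ , u₁≋v₁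
  agree (suc k) k<n with agree k (ℕₚ.<⇒≤ k<n)
  ... | uₖ≋vₖ , uₖ₊₁≋vₖ₊₁ = uₖ₊₁≋vₖ₊₁ , (begin
    u (suc (suc k))                         ≈⟨ residual-step u k ⟩
    residual u k ⊖ A ⊛ u (suc k) ⊖ X ⊛ u k ≈⟨ ⊖-cong (⊖-cong (same k (s≤s k<n)) (⊛-congˡ A uₖ₊₁≋vₖ₊₁))
                                                       (⊛-congˡ X uₖ≋vₖ) ⟩
    residual v k ⊖ A ⊛ v (suc k) ⊖ X ⊛ v k ≈⟨ R.sym (residual-step v k) ⟩
    v (suc (suc k))                         ∎)

residual-linear : ∀ a b u v m →
  residual (λ k → a ⊛ u k ⊕ b ⊛ v k) m ≋ a ⊛ residual u m ⊕ b ⊛ residual v m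
residual-linear a b u v m =
  solve 10 (λ a b α x u₀ u₁ u₂ v₀ v₁ v₂ →
              (a :* u₂ :+ b :* v₂) :+ α :* (a :* u₁ :+ b :* v₁) :+ x :* (a :* u₀ :+ b :* v₀)
           := a :* (u₂ :+ α :* u₁ :+ x :* u₀) :+ b :* (v₂ :+ α :* v₁ :+ x :* v₀))
        R.refl a b A X (u m) (u (suc m)) (u (suc (suc m))) (v m) (v (suc m)) (v (suc (suc m)))

residual-Dpoly : ∀ m → residual Dpoly m ≋ zeroₚ
residual-Dpoly m =
  solve 4 (λ α x d₀ d₁ → (con (+ 0) :- α :* d₁ :- x :* d₀) :+ α :* d₁ :+ x :* d₀ := con (+ 0))
        R.refl A X (Dpoly m) (Dpoly (suc m))

-- Dprev k = D_{k-1}; the value D_{-1} = 1 makes the recurrence hold from k = 0 on.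
Dprev : ℕ → PS
Dprev zero    = one
Dprev (suc k) = Dpoly k

residual-Dprev : ∀ m → residual Dprev m ≋ zeroₚ
residual-Dprev zero    =
  solve 1 (λ x → (con (+ 1) :- x :^ 2) :+ (x :^ 2 :- x :- con (+ 1)) :* con (+ 1) :+ x :* con (+ 1)
                 := con (+ 0)) R.refl X
residual-Dprev (suc m) = residual-Dpoly m

E : ℕ → PS
E zero          = zeroₚ
E (suc zero)    = one
E (suc (suc s)) = const ℚ.0ℚ ⊖ A ⊛ E (suc s) ⊖ X ⊛ E s

residual-E : ∀ m → residual E m ≋ zeroₚ
residual-E m =
  solve 4 (λ α x e₀ e₁ → (con (+ 0) :- α :* e₁ :- x :* e₀) :+ α :* e₁ :+ x :* e₀ := con (+ 0))
        R.refl A X (E m) (E (suc m))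

Dpoly≋E : ∀ s → Dpoly s ≋ E (suc s) ⊖ X ⊛ E s
Dpoly≋E zero          = solve 1 (λ x → con (+ 1) := con (+ 1) :- x :* con (+ 0)) R.refl X
Dpoly≋E (suc zero)    =
  solve 1 (λ x → con (+ 1) :- x :^ 2
               := (con (+ 0) :- (x :^ 2 :- x :- con (+ 1)) :* con (+ 1) :- x :* con (+ 0)) :- x :* con (+ 1))
        R.refl X
Dpoly≋E (suc (suc s)) = begin
  const ℚ.0ℚ ⊖ A ⊛ Dpoly (suc s) ⊖ X ⊛ Dpoly s
    ≈⟨ ⊖-cong (⊖-congˡ (const ℚ.0ℚ) (⊛-congˡ A (Dpoly≋E (suc s)))) (⊛-congˡ X (Dpoly≋E s)) ⟩
  const ℚ.0ℚ ⊖ A ⊛ (E (suc (suc s)) ⊖ X ⊛ E (suc s)) ⊖ X ⊛ (E (suc s) ⊖ X ⊛ E s)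
    ≈⟨ solve 5 (λ α x e₀ e₁ e₂ → con (+ 0) :- α :* (e₂ :- x :* e₁) :- x :* (e₁ :- x :* e₀)
                             := (con (+ 0) :- α :* e₂ :- x :* e₁) :- x :* (con (+ 0) :- α :* e₁ :- x :* e₀))
               R.refl A X (E s) (E (suc s)) (E (suc (suc s))) ⟩
  E (suc (suc (suc s))) ⊖ X ⊛ E (suc (suc s)) ∎

delay : ℕ → (ℕ → PS) → ℕ → PS
delay zero    u m       = u m
delay (suc k) u zero    = zeroₚ
delay (suc k) u (suc m) = delay k u m

delay-+ : ∀ k u j → delay k u (k + j) ≡ u j
delay-+ zero    u j = refl
delay-+ (suc k) u j = delay-+ k u j

delay-E-≤ : ∀ {k m} → m ≤ k → delay k E m ≡ zeroₚ
delay-E-≤ {zero}  z≤n       = refl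
delay-E-≤ {suc k} z≤n       = refl
delay-E-≤ {suc k} (s≤s m≤k) = delay-E-≤ m≤k

impulse : ℕ → ℕ → PS
impulse k m = const (if m ≡ᵇ k then 1ℚ else ℚ.0ℚ)

impulse-sift : ∀ (g : ℕ → PS) k m → g m ⊛ impulse k m ≋ g k ⊛ impulse k m
impulse-sift g k m with m ≡ᵇ k in m≡ᵇk
... | true  rewrite ℕₚ.≡ᵇ⇒≡ m k (subst T (sym m≡ᵇk) tt) = R.refl
... | false = R.trans (R.zeroʳ (g m)) (R.sym (R.zeroʳ (g k)))

residual-zeros : zeroₚ ⊕ A ⊛ zeroₚ ⊕ X ⊛ zeroₚ ≋ zeroₚ
residual-zeros =
  solve 2 (λ α x → con (+ 0) :+ α :* con (+ 0) :+ x :* con (+ 0) := con (+ 0)) R.refl A X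

residual-delay-E : ∀ k m → residual (delay (suc k) E) m ≋ impulse k m
residual-delay-E zero          zero    =
  solve 2 (λ α x → con (+ 1) :+ α :* con (+ 0) :+ x :* con (+ 0) := con (+ 1)) R.refl A X
residual-delay-E zero          (suc m) = residual-E m
residual-delay-E (suc zero)    zero    = residual-zeros
residual-delay-E (suc (suc k)) zero    = residual-zeros
residual-delay-E (suc k)       (suc m) = residual-delay-E k m

-- The numerator N = x² E_t

module _ (W : PS) (W²≋P : W ⊛ W ≋ P) where

  A²-W²≋4X : A ⊛ A ⊖ W ⊛ W ≋ ℤc (+ 4) ⊛ X
  A²-W²≋4X = begin
    A ⊛ A ⊖ W ⊛ W ≈⟨ ⊖-congˡ (A ⊛ A) W²≋P ⟩
    A ⊛ A ⊖ P     ≈⟨ solve 1 (λ x → (x :^ 2 :- x :- con (+ 1)) :* (x :^ 2 :- x :- con (+ 1))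
                                    :- (x :^ 4 :- con (+ 2) :* x :^ 3 :- x :^ 2 :- con (+ 2) :* x :+ con (+ 1))
                                  := con (+ 4) :* x) R.refl X ⟩
    ℤc (+ 4) ⊛ X  ∎

  root-powers : ∀ e → e ⊛ e ≋ W ⊛ W → ∀ t →
    (A ⊕ e) ^ₚ suc (suc t) ≋ ℤc (+ 2) ⊛ A ⊛ (A ⊕ e) ^ₚ suc t ⊖ ℤc (+ 4) ⊛ X ⊛ (A ⊕ e) ^ₚ t
  root-powers e e²≋W² t = begin
    (A ⊕ e) ⊛ ((A ⊕ e) ⊛ zₜ)
      ≈⟨ solve 3 (λ a e z → (a :+ e) :* ((a :+ e) :* z)
                         := con (+ 2) :* a :* ((a :+ e) :* z) :- (a :* a :- e :* e) :* z) R.refl A e zₜ ⟩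
    ℤc (+ 2) ⊛ A ⊛ ((A ⊕ e) ⊛ zₜ) ⊖ (A ⊛ A ⊖ e ⊛ e) ⊛ zₜ
      ≈⟨ ⊖-congˡ (ℤc (+ 2) ⊛ A ⊛ ((A ⊕ e) ⊛ zₜ))
                 (⊛-congʳ zₜ (R.trans (⊖-congˡ (A ⊛ A) e²≋W²) A²-W²≋4X)) ⟩
    ℤc (+ 2) ⊛ A ⊛ ((A ⊕ e) ⊛ zₜ) ⊖ ℤc (+ 4) ⊛ X ⊛ zₜ ∎
    where
    zₜ : PS
    zₜ = (A ⊕ e) ^ₚ t

  binet : ∀ t → (A ⊖ W) ^ₚ t ⊖ (A ⊕ W) ^ₚ t ≋ ℤc -[1+ 1 ] ^ₚ t ⊛ W ⊛ E t
  binet zero          = solve 1 (λ w → con (+ 1) :- con (+ 1) := con (+ 1) :* w :* con (+ 0)) R.refl W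
  binet (suc zero)    = solve 2 (λ a w → (a :- w) :* con (+ 1) :- (a :+ w) :* con (+ 1)
                                      := (con -[1+ 1 ] :* con (+ 1)) :* w :* con (+ 1)) R.refl A W
  binet (suc (suc t)) = begin
    (A ⊖ W) ^ₚ suc (suc t) ⊖ (A ⊕ W) ^ₚ suc (suc t)
      ≈⟨ ⊖-cong (root-powers (neg W) (solve 1 (λ w → (:- w) :* (:- w) := w :* w) R.refl W) t)
                (root-powers W R.refl t) ⟩
    ℤc (+ 2) ⊛ A ⊛ (A ⊖ W) ^ₚ suc t ⊖ ℤc (+ 4) ⊛ X ⊛ (A ⊖ W) ^ₚ t
      ⊖ (ℤc (+ 2) ⊛ A ⊛ (A ⊕ W) ^ₚ suc t ⊖ ℤc (+ 4) ⊛ X ⊛ (A ⊕ W) ^ₚ t)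
      ≈⟨ solve 6 (λ a x p₁ p₀ q₁ q₀ → con (+ 2) :* a :* p₁ :- con (+ 4) :* x :* p₀
                                      :- (con (+ 2) :* a :* q₁ :- con (+ 4) :* x :* q₀)
                                   := con (+ 2) :* a :* (p₁ :- q₁) :- con (+ 4) :* x :* (p₀ :- q₀))
               R.refl A X ((A ⊖ W) ^ₚ suc t) ((A ⊖ W) ^ₚ t) ((A ⊕ W) ^ₚ suc t) ((A ⊕ W) ^ₚ t) ⟩
    ℤc (+ 2) ⊛ A ⊛ ((A ⊖ W) ^ₚ suc t ⊖ (A ⊕ W) ^ₚ suc t) ⊖ ℤc (+ 4) ⊛ X ⊛ ((A ⊖ W) ^ₚ t ⊖ (A ⊕ W) ^ₚ t)
      ≈⟨ ⊖-cong (⊛-congˡ (ℤc (+ 2) ⊛ A) (binet (suc t))) (⊛-congˡ (ℤc (+ 4) ⊛ X) (binet t)) ⟩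
    ℤc (+ 2) ⊛ A ⊛ (ℤc -[1+ 1 ] ^ₚ suc t ⊛ W ⊛ E (suc t)) ⊖ ℤc (+ 4) ⊛ X ⊛ (ℤc -[1+ 1 ] ^ₚ t ⊛ W ⊛ E t)
      ≈⟨ solve 6 (λ a x c w e₁ e₀ → con (+ 2) :* a :* ((con -[1+ 1 ] :* c) :* w :* e₁)
                                      :- con (+ 4) :* x :* (c :* w :* e₀)
                                   := (con -[1+ 1 ] :* (con -[1+ 1 ] :* c)) :* w
                                      :* (con (+ 0) :- a :* e₁ :- x :* e₀))
               R.refl A X (ℤc -[1+ 1 ] ^ₚ t) W (E (suc t)) (E t) ⟩
    ℤc -[1+ 1 ] ^ₚ suc (suc t) ⊛ W ⊛ E (suc (suc t)) ∎

  N-equation : ∀ t →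
    X ^ₚ 2 ⊛ E t ⊛ ((W ⊛ A ⊛ A ⊖ W ⊛ W ⊛ W) ⊛ ((A ⊕ W) ^ₚ t ⊛ (A ⊖ W) ^ₚ t))
      ≋ ℤc ((+ (2 ^ (t + 2))) *ℤ (-[1+ 0 ] ^ℤ t)) ⊛ X ^ₚ (t + 3) ⊛ ((A ⊖ W) ^ₚ t ⊖ (A ⊕ W) ^ₚ t)
  N-equation t = begin
    X ^ₚ 2 ⊛ E t ⊛ ((W ⊛ A ⊛ A ⊖ W ⊛ W ⊛ W) ⊛ ((A ⊕ W) ^ₚ t ⊛ (A ⊖ W) ^ₚ t))
      ≈⟨ ⊛-congˡ (X ^ₚ 2 ⊛ E t) (R.*-cong denominator conjugates) ⟩
    X ^ₚ 2 ⊛ E t ⊛ ((W ⊛ (ℤc (+ 4) ⊛ X)) ⊛ (ℤc (+ 4) ^ₚ t ⊛ X ^ₚ t))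
      ≈⟨ solve 5 (λ x e w f y → x :^ 2 :* e :* ((w :* (con (+ 4) :* x)) :* (f :* y))
                             := (con (+ 4) :* f) :* (y :* x :^ 3 :* w :* e))
               R.refl X (E t) W (ℤc (+ 4) ^ₚ t) (X ^ₚ t) ⟩
    (ℤc (+ 4) ⊛ ℤc (+ 4) ^ₚ t) ⊛ (X ^ₚ t ⊛ X ^ₚ 3 ⊛ W ⊛ E t)
      ≈⟨ ⊛-congʳ (X ^ₚ t ⊛ X ^ₚ 3 ⊛ W ⊛ E t) (R.sym constants) ⟩
    (K ⊛ ℤc -[1+ 1 ] ^ₚ t) ⊛ (X ^ₚ t ⊛ X ^ₚ 3 ⊛ W ⊛ E t)
      ≈⟨ solve 6 (λ k c y x w e → (k :* c) :* (y :* x :^ 3 :* w :* e) := k :* (y :* x :^ 3) :* (c :* w :* e))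
               R.refl K (ℤc -[1+ 1 ] ^ₚ t) (X ^ₚ t) X W (E t) ⟩
    K ⊛ (X ^ₚ t ⊛ X ^ₚ 3) ⊛ (ℤc -[1+ 1 ] ^ₚ t ⊛ W ⊛ E t)
      ≈⟨ R.*-cong (⊛-congˡ K (R.sym (^ₚ-homo-⊛ X t 3))) (R.sym (binet t)) ⟩
    K ⊛ X ^ₚ (t + 3) ⊛ ((A ⊖ W) ^ₚ t ⊖ (A ⊕ W) ^ₚ t) ∎
    where
    K : PS
    K = ℤc ((+ (2 ^ (t + 2))) *ℤ (-[1+ 0 ] ^ℤ t))

    denominator : W ⊛ A ⊛ A ⊖ W ⊛ W ⊛ W ≋ W ⊛ (ℤc (+ 4) ⊛ X)
    denominator = R.trans (solve 2 (λ w a → w :* a :* a :- w :* w :* w := w :* (a :* a :- w :* w)) R.refl W A)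
                          (⊛-congˡ W A²-W²≋4X)

    difference-of-squares : (A ⊕ W) ⊛ (A ⊖ W) ≋ A ⊛ A ⊖ W ⊛ W
    difference-of-squares = solve 2 (λ a w → (a :+ w) :* (a :- w) := a :* a :- w :* w) R.refl A W

    conjugates : (A ⊕ W) ^ₚ t ⊛ (A ⊖ W) ^ₚ t ≋ ℤc (+ 4) ^ₚ t ⊛ X ^ₚ t
    conjugates = begin
      (A ⊕ W) ^ₚ t ⊛ (A ⊖ W) ^ₚ t  ≈⟨ R.sym (^ₚ-distrib-⊛ (A ⊕ W) (A ⊖ W) t) ⟩
      ((A ⊕ W) ⊛ (A ⊖ W)) ^ₚ t     ≈⟨ ^ₚ-congˡ t (R.trans difference-of-squares A²-W²≋4X) ⟩
      (ℤc (+ 4) ⊛ X) ^ₚ t          ≈⟨ ^ₚ-distrib-⊛ (ℤc (+ 4)) X t ⟩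
      ℤc (+ 4) ^ₚ t ⊛ X ^ₚ t       ∎

    constants : K ⊛ ℤc -[1+ 1 ] ^ₚ t ≋ ℤc (+ 4) ⊛ ℤc (+ 4) ^ₚ t
    constants = begin
      K ⊛ ℤc -[1+ 1 ] ^ₚ t
        ≈⟨ ⊛-congˡ K (R.sym (ℤc-^ -[1+ 1 ] t)) ⟩
      K ⊛ ℤc (-[1+ 1 ] ^ℤ t)
        ≈⟨ R.sym (ℤc-* (+ (2 ^ (t + 2)) *ℤ (-[1+ 0 ] ^ℤ t)) (-[1+ 1 ] ^ℤ t)) ⟩
      ℤc (+ (2 ^ (t + 2)) *ℤ (-[1+ 0 ] ^ℤ t) *ℤ (-[1+ 1 ] ^ℤ t))
        ≡⟨ cong ℤc (2^[t+2]*[-1]^t*[-2]^t≡4*4^t t) ⟩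
      ℤc (+ 4 *ℤ ((+ 4) ^ℤ t))
        ≈⟨ ℤc-* (+ 4) ((+ 4) ^ℤ t) ⟩
      ℤc (+ 4) ⊛ ℤc ((+ 4) ^ℤ t)
        ≈⟨ ⊛-congˡ (ℤc (+ 4)) (ℤc-^ (+ 4) t) ⟩
      ℤc (+ 4) ⊛ ℤc (+ 4) ^ₚ t ∎

≋-const⊕X⊛ : ∀ {F G} c → F 0 ≡ c → (∀ n → F (suc n) ≡ G n) → F ≋ const c ⊕ X ⊛ G
≋-const⊕X⊛ {F} {G} c F₀ F₊ = mk λ
  { zero    → trans F₀ (sym (trans (cong (c ℚ.+_) (X⊛-zero G)) (ℚₚ.+-identityʳ c)))
  ; (suc n) → trans (F₊ n) (sym (trans (cong (ℚ.0ℚ ℚ.+_) (X⊛-suc G n)) (ℚₚ.+-identityˡ (G n))))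
  }

X⊛-cancel : ∀ {F H} → X ⊛ F ≋ X ⊛ H → F ≋ H
X⊛-cancel {F} {H} XF≋XH = mk (λ n → trans (sym (X⊛-suc F n)) (trans (un XF≋XH (suc n)) (X⊛-suc H n)))

X^-cancel : ∀ k {F H} → X ^ₚ k ⊛ F ≋ X ^ₚ k ⊛ H → F ≋ H
X^-cancel zero    {F} {H} eq = R.trans (R.sym (R.*-identityˡ F)) (R.trans eq (R.*-identityˡ H))
X^-cancel (suc k) {F} {H} eq =
  X^-cancel k (X⊛-cancel (R.trans (R.sym (R.*-assoc X (X ^ₚ k) F)) (R.trans eq (R.*-assoc X (X ^ₚ k) H))))

toℚ-if : ∀ b → toℚ (+ (if b then 1 else 0)) ≡ (if b then 1ℚ else ℚ.0ℚ)
toℚ-if true  = refl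
toℚ-if false = refl

≤ᵇ-false : ∀ {m n} → n < m → (m ≤ᵇ n) ≡ false
≤ᵇ-false {m} {n} n<m with m ≤ᵇ n in m≤ᵇn
... | false = refl
... | true  = ⊥-elim (ℕₚ.<⇒≱ n<m (ℕₚ.≤ᵇ⇒≤ m n (subst T (sym m≤ᵇn) tt)))

module WalkSeries (L target : ℕ) where
  open Strip L target

  walks : ℕ → Bool → PS
  walks m f n = toℚ (+ count m f n)

  walksBelow : ℕ → PS
  walksBelow zero    = zeroₚ
  walksBelow (suc j) = walks j true ⊕ walksBelow j

  walksBelow-coeff : ∀ b n → toℚ (+ countBelow b n) ≡ walksBelow b n
  walksBelow-coeff zero    n = sym (zeroₚ≡0 n)
  walksBelow-coeff (suc b) n =
    trans (toℚ-+ (+ count b true n) (+ countBelow b n)) (cong (walks b true n ℚ.+_) (walksBelow-coeff b n))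

  module _ {m} (m≤L : m ≤ L) where

    private
      m≤ᵇL : (m ≤ᵇ L) ≡ true
      m≤ᵇL = to T-≡ (ℕₚ.≤⇒≤ᵇ m≤L)

      count-suc : ∀ f n → count m f (suc n) ≡ count (suc m) false n + countDown m f n
      count-suc f n = cong (λ b → if b then count (suc m) false n + countDown m f n else 0) m≤ᵇL

      walks-zero : ∀ f → walks m f 0 ≡ (if m ≡ᵇ target then 1ℚ else ℚ.0ℚ)
      walks-zero f = trans (cong (λ b → toℚ (+ (if b ∧ (m ≡ᵇ target) then 1 else 0))) m≤ᵇL)
                           (toℚ-if (m ≡ᵇ target))

    walks-afterDown : walks m true ≋ impulse target m ⊕ X ⊛ walks (suc m) false
    walks-afterDown = ≋-const⊕X⊛ _ (walks-zero true)
      (λ n → cong (toℚ ∘ +_) (trans (count-suc true n) (ℕₚ.+-identityʳ _)))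

    walks-free : walks m false ≋ impulse target m ⊕ X ⊛ (walks (suc m) false ⊕ walksBelow m)
    walks-free = ≋-const⊕X⊛ _ (walks-zero false)
      (λ n → trans (cong (toℚ ∘ +_) (count-suc false n))
                   (trans (toℚ-+ (+ count (suc m) false n) (+ countBelow m n))
                          (cong (walks (suc m) false n ℚ.+_) (walksBelow-coeff m n))))

  walks-outside : ∀ {m} f → L < m → walks m f ≋ zeroₚ
  walks-outside {m} f L<m = mk λ
    { zero    → cong (λ b → toℚ (+ (if b ∧ (m ≡ᵇ target) then 1 else 0))) (≤ᵇ-false L<m)
    ; (suc n) → cong (λ b → toℚ (+ (if b then count (suc m) false n + countDown m f n else 0))) (≤ᵇ-false L<m)
    }

  walk-recurrence : ∀ m → suc m ≤ L →
    X ⊛ walks (suc (suc m)) false ⊕ A ⊛ walks (suc m) false ⊕ walks m false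
      ≋ (one ⊖ X) ⊛ impulse target m ⊖ impulse target (suc m)
  walk-recurrence m m<L = begin
    X ⊛ T₂ ⊕ A ⊛ T₁ ⊕ T₀
      ≈⟨ ⊕-congˡ (X ⊛ T₂ ⊕ A ⊛ T₁) (walks-free m≤L) ⟩
    X ⊛ T₂ ⊕ A ⊛ T₁ ⊕ (d₀ ⊕ X ⊛ (T₁ ⊕ σ))
      ≈⟨ solve 5 (λ x t₂ t₁ σ d₀ → x :* t₂ :+ (x :^ 2 :- x :- con (+ 1)) :* t₁ :+ (d₀ :+ x :* (t₁ :+ σ))
                                := (x :^ 2 :* t₁ :+ x :* t₂ :+ x :* σ :+ d₀) :- t₁) R.refl X T₂ T₁ σ d₀ ⟩
    X ^ₚ 2 ⊛ T₁ ⊕ X ⊛ T₂ ⊕ X ⊛ σ ⊕ d₀ ⊖ T₁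
      ≈⟨ ⊖-congˡ (X ^ₚ 2 ⊛ T₁ ⊕ X ⊛ T₂ ⊕ X ⊛ σ ⊕ d₀) (walks-free m<L) ⟩
    X ^ₚ 2 ⊛ T₁ ⊕ X ⊛ T₂ ⊕ X ⊛ σ ⊕ d₀ ⊖ (d₁ ⊕ X ⊛ (T₂ ⊕ (S₀ ⊕ σ)))
      ≈⟨ solve 7 (λ x t₂ t₁ s₀ σ d₀ d₁ → x :^ 2 :* t₁ :+ x :* t₂ :+ x :* σ :+ d₀
                                         :- (d₁ :+ x :* (t₂ :+ (s₀ :+ σ)))
                                      := d₀ :- d₁ :+ x :* (x :* t₁ :- s₀)) R.refl X T₂ T₁ S₀ σ d₀ d₁ ⟩
    d₀ ⊖ d₁ ⊕ X ⊛ (X ⊛ T₁ ⊖ S₀)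
      ≈⟨ ⊕-congˡ (d₀ ⊖ d₁) (⊛-congˡ X (⊖-congˡ (X ⊛ T₁) (walks-afterDown m≤L))) ⟩
    d₀ ⊖ d₁ ⊕ X ⊛ (X ⊛ T₁ ⊖ (d₀ ⊕ X ⊛ T₁))
      ≈⟨ solve 4 (λ x t₁ d₀ d₁ → d₀ :- d₁ :+ x :* (x :* t₁ :- (d₀ :+ x :* t₁)) := (con (+ 1) :- x) :* d₀ :- d₁)
               R.refl X T₁ d₀ d₁ ⟩
    (one ⊖ X) ⊛ d₀ ⊖ d₁ ∎
    where
    m≤L : m ≤ L
    m≤L = ℕₚ.<⇒≤ m<L
    T₀ T₁ T₂ S₀ σ d₀ d₁ : PS
    T₀ = walks m false
    T₁ = walks (suc m) false
    T₂ = walks (suc (suc m)) false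
    S₀ = walks m true
    σ  = walksBelow m
    d₀ = impulse target m
    d₁ = impulse target (suc m)

  scaled : ℕ → PS
  scaled m = X ^ₚ m ⊛ walks m false

  residual-scaled : ∀ m → suc m ≤ L →
    residual scaled m ≋ X ^ₚ suc m ⊛ ((one ⊖ X) ⊛ impulse target m ⊖ impulse target (suc m))
  residual-scaled m m<L = begin
    residual scaled m
      ≈⟨ solve 6 (λ x y a t₀ t₁ t₂ → (x :* (x :* y)) :* t₂ :+ a :* ((x :* y) :* t₁) :+ x :* (y :* t₀)
                                  := (x :* y) :* (x :* t₂ :+ a :* t₁ :+ t₀))
               R.refl X (X ^ₚ m) A (walks m false) (walks (suc m) false) (walks (suc (suc m)) false) ⟩
    X ^ₚ suc m ⊛ (X ⊛ walks (suc (suc m)) false ⊕ A ⊛ walks (suc m) false ⊕ walks m false)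
      ≈⟨ ⊛-congˡ (X ^ₚ suc m) (walk-recurrence m m<L) ⟩
    X ^ₚ suc m ⊛ ((one ⊖ X) ⊛ impulse target m ⊖ impulse target (suc m)) ∎

-- Solving the recurrence in the strip [0, 2t]

module CenteredStrip (s : ℕ) where
  t : ℕ
  t = suc s
  open WalkSeries (t + t) t

  fromBottom : PS
  fromBottom = walks 0 false

  targetResponse : ℕ → PS
  targetResponse m = X ⊛ (one ⊖ X) ⊛ delay (suc t) E m ⊕ ℤc -[1+ 0 ] ⊛ delay t E m

  closedForm : ℕ → PS
  closedForm m = fromBottom ⊛ Dprev m ⊕ X ^ₚ t ⊛ targetResponse m

  targetResponse-≤ : ∀ {m} → m ≤ t → targetResponse m ≋ zeroₚ
  targetResponse-≤ {m} m≤t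
    rewrite delay-E-≤ (ℕₚ.m≤n⇒m≤1+n m≤t) | delay-E-≤ m≤t =
      solve 1 (λ x → x :* (con (+ 1) :- x) :* con (+ 0) :+ con -[1+ 0 ] :* con (+ 0) := con (+ 0)) R.refl X

  closedForm-≤ : ∀ {m} → m ≤ t → closedForm m ≋ fromBottom ⊛ Dprev m
  closedForm-≤ {m} m≤t = begin
    fromBottom ⊛ Dprev m ⊕ X ^ₚ t ⊛ targetResponse m
      ≈⟨ ⊕-congˡ (fromBottom ⊛ Dprev m) (⊛-congˡ (X ^ₚ t) (targetResponse-≤ m≤t)) ⟩
    fromBottom ⊛ Dprev m ⊕ X ^ₚ t ⊛ zeroₚ
      ≈⟨ solve 2 (λ d y → d :+ y :* con (+ 0) := d) R.refl (fromBottom ⊛ Dprev m) (X ^ₚ t) ⟩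
    fromBottom ⊛ Dprev m ∎

  residual-closedForm : ∀ m →
    residual closedForm m ≋ X ^ₚ t ⊛ (X ⊛ (one ⊖ X) ⊛ impulse t m ⊕ ℤc -[1+ 0 ] ⊛ impulse s m)
  residual-closedForm m = begin
    residual closedForm m
      ≈⟨ residual-linear fromBottom (X ^ₚ t) Dprev targetResponse m ⟩
    fromBottom ⊛ residual Dprev m ⊕ X ^ₚ t ⊛ residual targetResponse m
      ≈⟨ R.+-cong (⊛-congˡ fromBottom (residual-Dprev m)) (⊛-congˡ (X ^ₚ t) residual-targetResponse) ⟩
    fromBottom ⊛ zeroₚ ⊕ X ^ₚ t ⊛ (X ⊛ (one ⊖ X) ⊛ impulse t m ⊕ ℤc -[1+ 0 ] ⊛ impulse s m)
      ≈⟨ solve 2 (λ b r → b :* con (+ 0) :+ r := r) R.refl fromBottom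
                 (X ^ₚ t ⊛ (X ⊛ (one ⊖ X) ⊛ impulse t m ⊕ ℤc -[1+ 0 ] ⊛ impulse s m)) ⟩
    X ^ₚ t ⊛ (X ⊛ (one ⊖ X) ⊛ impulse t m ⊕ ℤc -[1+ 0 ] ⊛ impulse s m) ∎
    where
    residual-targetResponse :
      residual targetResponse m ≋ X ⊛ (one ⊖ X) ⊛ impulse t m ⊕ ℤc -[1+ 0 ] ⊛ impulse s m
    residual-targetResponse =
      R.trans (residual-linear (X ⊛ (one ⊖ X)) (ℤc -[1+ 0 ]) (delay (suc t) E) (delay t E) m)
              (R.+-cong (⊛-congˡ (X ⊛ (one ⊖ X)) (residual-delay-E t m))
                        (⊛-congˡ (ℤc -[1+ 0 ]) (residual-delay-E s m)))

  residual-scaled≋closedForm : ∀ m → suc m ≤ t + t → residual scaled m ≋ residual closedForm m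
  residual-scaled≋closedForm m m<2t = begin
    residual scaled m
      ≈⟨ residual-scaled m m<2t ⟩
    X ^ₚ suc m ⊛ ((one ⊖ X) ⊛ impulse t m ⊖ impulse s m)
      ≈⟨ solve 4 (λ y z δₜ δₛ → y :* ((con (+ 1) :- z) :* δₜ :- δₛ)
                             := (con (+ 1) :- z) :* (y :* δₜ) :- y :* δₛ)
               R.refl (X ^ₚ suc m) X (impulse t m) (impulse s m) ⟩
    (one ⊖ X) ⊛ (X ^ₚ suc m ⊛ impulse t m) ⊖ X ^ₚ suc m ⊛ impulse s m
      ≈⟨ ⊖-cong (⊛-congˡ (one ⊖ X) (impulse-sift (λ k → X ^ₚ suc k) t m))
                (impulse-sift (λ k → X ^ₚ suc k) s m) ⟩
    (one ⊖ X) ⊛ (X ⊛ X ^ₚ t ⊛ impulse t m) ⊖ X ^ₚ t ⊛ impulse s m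
      ≈⟨ solve 4 (λ x y δₜ δₛ → (con (+ 1) :- x) :* (x :* y :* δₜ) :- y :* δₛ
                             := y :* (x :* (con (+ 1) :- x) :* δₜ :+ con -[1+ 0 ] :* δₛ))
               R.refl X (X ^ₚ t) (impulse t m) (impulse s m) ⟩
    X ^ₚ t ⊛ (X ⊛ (one ⊖ X) ⊛ impulse t m ⊕ ℤc -[1+ 0 ] ⊛ impulse s m)
      ≈⟨ R.sym (residual-closedForm m) ⟩
    residual closedForm m ∎

  scaled≋closedForm : ∀ n → n ≤ suc (t + t) → scaled n ≋ closedForm n
  scaled≋closedForm n n≤2t+1 = residual-unique {scaled} {closedForm} n
    (λ m 2+m≤n → residual-scaled≋closedForm m (ℕₚ.≤-pred (ℕₚ.≤-trans 2+m≤n n≤2t+1)))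
    (begin
      one ⊛ fromBottom      ≈⟨ R.*-comm one fromBottom ⟩
      fromBottom ⊛ one      ≈⟨ R.sym (closedForm-≤ z≤n) ⟩
      closedForm 0  ∎)
    (begin
      X ⊛ one ⊛ walks 1 false
        ≈⟨ solve 2 (λ x t₁ → x :* con (+ 1) :* t₁ := (con (+ 0) :+ x :* (t₁ :+ con (+ 0))) :* con (+ 1))
                 R.refl X (walks 1 false) ⟩
      (const ℚ.0ℚ ⊕ X ⊛ (walks 1 false ⊕ zeroₚ)) ⊛ one
        ≈⟨ ⊛-congʳ one (R.sym (walks-free z≤n)) ⟩
      fromBottom ⊛ one
        ≈⟨ R.sym (closedForm-≤ (s≤s z≤n)) ⟩
      closedForm 1 ∎)

  targetResponse-top : targetResponse (suc (t + t)) ≋ X ⊛ (one ⊖ X) ⊛ E t ⊕ ℤc -[1+ 0 ] ⊛ E (suc t)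
  targetResponse-top = R.reflexive (cong₂ (λ a b → X ⊛ (one ⊖ X) ⊛ a ⊕ ℤc -[1+ 0 ] ⊛ b)
    (delay-+ t E t) (trans (cong (delay t E) (sym (ℕₚ.+-suc t t))) (delay-+ t E (suc t))))

  at-target : X ^ₚ t ⊛ walks t false ≋ fromBottom ⊛ Dpoly s
  at-target = R.trans (scaled≋closedForm t (ℕₚ.≤-trans (ℕₚ.m≤m+n t t) (ℕₚ.n≤1+n (t + t))))
                   (closedForm-≤ ℕₚ.≤-refl)

  above-strip : fromBottom ⊛ Dpoly (t + t) ≋ X ^ₚ t ⊛ (Dpoly t ⊕ X ^ₚ 2 ⊛ E t)
  above-strip = begin
    fromBottom ⊛ Dpoly (t + t)
      ≈⟨ solve 2 (λ d r → d := (d :+ r) :- r) R.refl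
               (fromBottom ⊛ Dpoly (t + t)) (X ^ₚ t ⊛ targetResponse (suc (t + t))) ⟩
    closedForm (suc (t + t)) ⊖ X ^ₚ t ⊛ targetResponse (suc (t + t))
      ≈⟨ ⊖-cong (R.trans (R.sym (scaled≋closedForm (suc (t + t)) ℕₚ.≤-refl)) outside)
                (⊛-congˡ (X ^ₚ t) targetResponse-top) ⟩
    zeroₚ ⊖ X ^ₚ t ⊛ (X ⊛ (one ⊖ X) ⊛ E t ⊕ ℤc -[1+ 0 ] ⊛ E (suc t))
      ≈⟨ solve 4 (λ x y e₀ e₁ → con (+ 0) :- y :* (x :* (con (+ 1) :- x) :* e₀ :+ con -[1+ 0 ] :* e₁)
                             := y :* (e₁ :- x :* e₀ :+ x :^ 2 :* e₀)) R.refl X (X ^ₚ t) (E t) (E (suc t)) ⟩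
    X ^ₚ t ⊛ (E (suc t) ⊖ X ⊛ E t ⊕ X ^ₚ 2 ⊛ E t)
      ≈⟨ ⊛-congˡ (X ^ₚ t) (⊕-congʳ (X ^ₚ 2 ⊛ E t) (R.sym (Dpoly≋E t))) ⟩
    X ^ₚ t ⊛ (Dpoly t ⊕ X ^ₚ 2 ⊛ E t) ∎
    where
    outside : scaled (suc (t + t)) ≋ zeroₚ
    outside = R.trans (⊛-congˡ (X ^ₚ suc (t + t)) (walks-outside false ℕₚ.≤-refl))
                      (R.zeroʳ (X ^ₚ suc (t + t)))

  generatingFunction-identity : ∀ G → G ≋ walks t false →
                                G ⊛ Dpoly (t + t) ≋ Dpoly s ⊛ (Dpoly t ⊕ X ^ₚ 2 ⊛ E t)
  generatingFunction-identity G G≋T = X^-cancel t (begin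
    X ^ₚ t ⊛ (G ⊛ Dpoly (t + t))
      ≈⟨ R.sym (R.*-assoc (X ^ₚ t) G (Dpoly (t + t))) ⟩
    X ^ₚ t ⊛ G ⊛ Dpoly (t + t)
      ≈⟨ ⊛-congʳ (Dpoly (t + t)) (R.trans (⊛-congˡ (X ^ₚ t) G≋T) at-target) ⟩
    fromBottom ⊛ Dpoly s ⊛ Dpoly (t + t)
      ≈⟨ solve 3 (λ b d e → b :* d :* e := d :* (b :* e)) R.refl fromBottom (Dpoly s) (Dpoly (t + t)) ⟩
    Dpoly s ⊛ (fromBottom ⊛ Dpoly (t + t))
      ≈⟨ ⊛-congˡ (Dpoly s) above-strip ⟩
    Dpoly s ⊛ (X ^ₚ t ⊛ N)
      ≈⟨ solve 3 (λ d y n → d :* (y :* n) := y :* (d :* n)) R.refl (Dpoly s) (X ^ₚ t) N ⟩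
    X ^ₚ t ⊛ (Dpoly s ⊛ N) ∎)
    where
    N : PS
    N = Dpoly t ⊕ X ^ₚ 2 ⊛ E t

BoundedGDAP↔Walk : ∀ t n → BoundedGDAP t n ↔ Strip.Walk (t + t) t t false n
BoundedGDAP↔Walk t n = mk↔ₛ′
  (λ (p , l , w) → p , l , subst T (isBoundedGDAP≡isWalk t p) w)
  (λ (p , l , w) → p , l , subst T (sym (isBoundedGDAP≡isWalk t p)) w)
  (λ (p , l , w) → cong (λ w → p , l , w) (T-irrelevant _ _))
  (λ (p , l , w) → cong (λ w → p , l , w) (T-irrelevant _ _))

counts≋walks : ∀ t (G : PS) → (∀ n → Σ ℕ (λ k → (G n ≡ (+ k) / 1) × (Fin k ↔ BoundedGDAP t n))) →
               G ≋ WalkSeries.walks (t + t) t t false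
counts≋walks t G counts = mk λ n →
  let (k , Gₙ≡k , k↔paths) = counts n in
  trans Gₙ≡k (cong (λ k → (+ k) / 1)
    (↔⇒≡ (↔-trans k↔paths (↔-trans (BoundedGDAP↔Walk t n) (↔-sym (Strip.count↔Walk (t + t) t n t false))))))

theorem6 : (t : ℕ) → 1 ≤ t →
    (W : PS) → W 0 ≡ 1ℚ → W ⊛ W ≈ P →
    (G : PS) → (∀ n → Σ ℕ (λ c → (G n ≡ (+ c) / 1) × (Fin c ↔ BoundedGDAP t n))) →
    Σ PS (λ N →
      (N ⊛ ((W ⊛ A ⊛ A ⊖ W ⊛ W ⊛ W) ⊛ ((A ⊕ W) ^ₚ t ⊛ (A ⊖ W) ^ₚ t))
        ≈ ℤc ((+ (2 ^ (t + 2))) *ℤ (-[1+ 0 ] ^ℤ t)) ⊛ X ^ₚ (t + 3)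
            ⊛ ((A ⊖ W) ^ₚ t ⊖ (A ⊕ W) ^ₚ t))
      × (G ⊛ Dpoly (2 * t) ≈ Dpoly (t ∸ 1) ⊛ (Dpoly t ⊕ N)))
theorem6 (suc s) (s≤s z≤n) W _ W²≈P G counts =
  X ^ₚ 2 ⊛ E t ,
  un (N-equation W (mk W²≈P) t) ,
  un (subst (λ k → G ⊛ Dpoly k ≋ Dpoly s ⊛ (Dpoly t ⊕ X ^ₚ 2 ⊛ E t))
            (cong (λ k → t + k) (sym (ℕₚ.+-identityʳ t)))
            (CenteredStrip.generatingFunction-identity s G (counts≋walks t G counts)))
  where
  t : ℕ
  t = suc s
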